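{- Let $k\ge 5$ and $s$ be positive integers, let $x_i,y_i\in\{0,1\}^k$ for $i=1,\dots,s$, and let $$A=(a_{ij})=\begin{bmatrix} T_k & X\\ Y & C_s\end{bmatrix},$$ where $X$ is the $k\times s$ matrix with columns $x_1,\dots,x_s$, $Y$ is the $s\times k$ matrix with rows $y_1^T,\dots,y_s^T$, and $C_s$ is the $s\times s$ $0$-$1$ matrix whose only entries equal to $1$ are the $(i,i+1)$-entries for $1\le i\le s-1$ and the $(s,1)$-entry. (i) If there is some $i\in\{1,\dots,s\}$ with $f(x_i)\ge 3$ or $f(y_i)\ge 3$, then $A\notin\Gamma(k+s,p)$ for every integer $p\ge 2$. (ii) If $s=2$ and there is some $i\in\{1,2\}$ with $f(x_i)=f(y_i)=2$, then $A\notin\Gamma(k+s,p)$ for every integer $p\ge 5$.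
   Context: $T_k$ is the $k\times k$ matrix with $(i,j)$-entry $1$ if $i<j$ and $0$ otherwise. For a $0$-$1$ vector $v$, $f(v)$ is its number of entries equal to $1$. $\Gamma(n,p)$ is the set of $n\times n$ $0$-$1$ matrices $A$ such that every entry of the (integer) matrix power $A^p$ is $0$ or $1$. -}

module Defs where

open import Data.Nat using (ℕ; zero; suc; _+_; _*_; _<_; _≤_; _%_)
open import Data.Nat.Properties using (_<?_; _≟_)
open import Data.Fin using (Fin; toℕ; splitAt)
open import Data.Bool using (Bool; true; false)
open import Data.Sum using (inj₁; inj₂)
open import Data.Vec.Functional using (Vector)
open import Relation.Nullary.Decidable using (⌊_⌋)

Matrix : ℕ → Set
Matrix n = Fin n → Fin n → ℕ

∑ : ∀ {n} → (Fin n → ℕ) → ℕ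
∑ {zero} f = 0
∑ {suc n} f = f Fin.zero + ∑ (λ i → f (Fin.suc i))

_⊗_ : ∀ {n} → Matrix n → Matrix n → Matrix n
(A ⊗ B) i j = ∑ (λ l → A i l * B l j)

identity : ∀ {n} → Matrix n
identity i j = if ⌊ toℕ i ≟ toℕ j ⌋ then 1 else 0
  where open import Data.Bool using (if_then_else_)

_^ᴹ_ : ∀ {n} → Matrix n → ℕ → Matrix n
A ^ᴹ zero = identity
A ^ᴹ suc p = A ⊗ (A ^ᴹ p)

Is01 : ∀ {n} → Matrix n → Set
Is01 A = ∀ i j → A i j ≤ 1

Γ : (n p : ℕ) → Matrix n → Set
Γ n p A = Is01 A × Is01 (A ^ᴹ p)
  where open import Data.Product using (_×_)

b2n : Bool → ℕ
b2n true = 1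
b2n false = 0

f : ∀ {k} → Vector Bool k → ℕ
f v = ∑ (λ i → b2n (v i))

T : (k : ℕ) → Matrix k
T k i j = b2n ⌊ toℕ i <? toℕ j ⌋

-- C_s : 1 exactly at (i,i+1) for 1 ≤ i ≤ s-1 and at (s,1);
-- in 0-based indices: j = (i+1) mod s
C : (s : ℕ) → Matrix s
C zero ()
C (suc s) i j = b2n ⌊ toℕ j ≟ (suc (toℕ i)) % (suc s) ⌋

blockA : (k s : ℕ) → (x y : Fin s → Vector Bool k) → Matrix (k + s)
blockA k s x y i j with splitAt k i | splitAt k j
... | inj₁ a | inj₁ b = T k a b
... | inj₁ a | inj₂ b = b2n (x b a)
... | inj₂ a | inj₁ b = b2n (y a b)
... | inj₂ a | inj₂ b = C s a b

-- Both parts exhibit two distinct walks of length p between the same pair of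
-- vertices of the digraph of A, so that the corresponding entry of A^p is at
-- least 2.  T_k gives every shortcut i → j with i < j, and the cycle C_s lets a
-- walk be padded to any length.  In (i), three ones in x_i give the fork
-- r₁ → r₂ → (k+i) and r₁ → r₃ → (k+i), continued along the cycle; three ones in
-- y_i give the fork (k+i) → c₁ → c₃ and (k+i) → c₂ → c₃, preceded by cycle steps.
-- In (ii), with x_i = e_a + e_b and y_i = e_c + e_d, the walks a → b → (k+i) ⇝ d
-- and a → (k+i) ⇝ d exist for every length, because from k+i the vertex d is
-- reached in one step directly, in two steps via c, and the 2-cycle adds any
-- even number of steps.
module Submission where

open import Defs
open import Data.Nat using (ℕ; zero; suc; _+_; _*_; _≤_; _≥_; _%_; z≤n; s≤s)
open import Data.Nat.Properties
  using (≤-refl; ≤-trans; ≤-reflexive; <-trans; <-irrefl; *-mono-≤; +-mono-≤; +-monoʳ-≤;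
         +-cancelˡ-≤; +-comm; *-identityˡ; _≟_; _<?_; m≤m+n; m≤n+m)
open import Data.Nat.DivMod using (m%n<n; n%n≡0; m<n⇒m%n≡m)
open import Data.Fin as Fin using (Fin; toℕ; splitAt; _↑ˡ_; _↑ʳ_; fromℕ<; fromℕ; inject₁)
open import Data.Fin.Properties
  using (↑ˡ-injective; splitAt-↑ˡ; splitAt-↑ʳ; <⇒≢; toℕ-fromℕ<; toℕ-fromℕ; toℕ-inject₁; toℕ<n)
open import Data.Bool using (Bool; true; false)
open import Data.Product using (_×_; _,_; ∃-syntax)
open import Data.Sum using (_⊎_; inj₁; inj₂)
open import Data.Vec.Functional using (Vector)
open import Relation.Nullary using (¬_; Dec; yes; no; contradiction)
open import Relation.Nullary.Decidable using (⌊_⌋)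
open import Relation.Binary.PropositionalEquality using (_≡_; _≢_; refl; sym; trans; cong; subst)

b2n-⌊⌋ : ∀ {ℓ} {P : Set ℓ} (P? : Dec P) → P → b2n ⌊ P? ⌋ ≡ 1
b2n-⌊⌋ (yes _) _  = refl
b2n-⌊⌋ (no ¬p) p = contradiction p ¬p

1≤-reflexive : ∀ {m} → m ≡ 1 → 1 ≤ m
1≤-reflexive refl = ≤-refl

∑-≥-term : ∀ {n} (g : Fin n → ℕ) l → g l ≤ ∑ g
∑-≥-term g Fin.zero    = m≤m+n _ _
∑-≥-term g (Fin.suc l) = ≤-trans (∑-≥-term (λ i → g (Fin.suc i)) l) (m≤n+m _ _)

∑-≥-two-terms : ∀ {n} (g : Fin n → ℕ) {l l′} → l ≢ l′ → g l + g l′ ≤ ∑ g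
∑-≥-two-terms g {Fin.zero}  {Fin.zero}   l≢l′ = contradiction refl l≢l′
∑-≥-two-terms g {Fin.zero}  {Fin.suc l′} _    = +-monoʳ-≤ (g Fin.zero) (∑-≥-term _ l′)
∑-≥-two-terms g {Fin.suc l} {Fin.zero}   _    =
  ≤-trans (≤-reflexive (+-comm (g (Fin.suc l)) (g Fin.zero)))
          (+-monoʳ-≤ (g Fin.zero) (∑-≥-term _ l))
∑-≥-two-terms g {Fin.suc l} {Fin.suc l′} l≢l′ =
  ≤-trans (∑-≥-two-terms (λ i → g (Fin.suc i)) (λ e → l≢l′ (cong Fin.suc e))) (m≤n+m _ _)

identity-diagonal : ∀ {n} (j : Fin n) → 1 ≤ identity j j
identity-diagonal j with toℕ j ≟ toℕ j
... | yes _  = ≤-refl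
... | no j≢j = contradiction refl j≢j

2≤⇒¬Is01 : ∀ {n} {M : Matrix n} i j → 2 ≤ M i j → ¬ Is01 M
2≤⇒¬Is01 i j 2≤Mij is01 = <-irrefl refl (≤-trans 2≤Mij (is01 i j))

module Walks {n : ℕ} (A : Matrix n) where

  ^ᴹ-step : ∀ {c} p i l j → 1 ≤ A i l → c ≤ (A ^ᴹ p) l j → c ≤ (A ^ᴹ suc p) i j
  ^ᴹ-step p i l j 1≤Ail c≤Aᵖlj =
    ≤-trans (≤-trans (≤-reflexive (sym (*-identityˡ _))) (*-mono-≤ 1≤Ail c≤Aᵖlj)) (∑-≥-term (λ m → A i m * (A ^ᴹ p) m j) l)

  ^ᴹ-fork : ∀ p i {l l′} j → l ≢ l′ → 1 ≤ A i l → 1 ≤ A i l′ →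
            1 ≤ (A ^ᴹ p) l j → 1 ≤ (A ^ᴹ p) l′ j → 2 ≤ (A ^ᴹ suc p) i j
  ^ᴹ-fork p i j l≢l′ 1≤Ail 1≤Ail′ 1≤Aᵖlj 1≤Aᵖl′j =
    ≤-trans (+-mono-≤ (*-mono-≤ 1≤Ail 1≤Aᵖlj) (*-mono-≤ 1≤Ail′ 1≤Aᵖl′j))
            (∑-≥-two-terms (λ m → A i m * (A ^ᴹ p) m j) l≢l′)

  ^ᴹ-one : ∀ i j → 1 ≤ A i j → 1 ≤ (A ^ᴹ 1) i j
  ^ᴹ-one i j 1≤Aij = ^ᴹ-step 0 i j j 1≤Aij (identity-diagonal j)

  module _ {m : ℕ} (ι : Fin m → Fin n) where

    ^ᴹ-out-closed : (∀ a → ∃[ b ] 1 ≤ A (ι a) (ι b)) → ∀ q a → ∃[ w ] 1 ≤ (A ^ᴹ q) (ι a) w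
    ^ᴹ-out-closed out zero    a = ι a , identity-diagonal (ι a)
    ^ᴹ-out-closed out (suc q) a with out a
    ... | b , 1≤Aab with ^ᴹ-out-closed out q b
    ... | w , 1≤Aᑫbw = w , ^ᴹ-step q (ι a) (ι b) w 1≤Aab 1≤Aᑫbw

    ^ᴹ-in-closed : (∀ a → ∃[ b ] 1 ≤ A (ι b) (ι a)) →
                   ∀ {c} q p a j → c ≤ (A ^ᴹ p) (ι a) j → ∃[ b ] c ≤ (A ^ᴹ (q + p)) (ι b) j
    ^ᴹ-in-closed into zero    p a j c≤Aᵖaj = a , c≤Aᵖaj
    ^ᴹ-in-closed into (suc q) p a j c≤Aᵖaj with ^ᴹ-in-closed into q p a j c≤Aᵖaj
    ... | b , c≤Aᑫ⁺ᵖbj with into b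
    ... | b′ , 1≤Ab′b = b′ , ^ᴹ-step (q + p) (ι b′) (ι b) j 1≤Ab′b c≤Aᑫ⁺ᵖbj

true-entry : ∀ {k} (v : Vector Bool k) → f v ≥ 1 → ∃[ r ] v r ≡ true
true-entry {suc k} v f≥1 with v Fin.zero in v₀
... | true  = Fin.zero , v₀
... | false with true-entry (λ i → v (Fin.suc i)) f≥1
...   | r , vr = Fin.suc r , vr

two-true-entries : ∀ {k} (v : Vector Bool k) → f v ≥ 2 →
                   ∃[ r₁ ] ∃[ r₂ ] (r₁ Fin.< r₂ × v r₁ ≡ true × v r₂ ≡ true)
two-true-entries {suc k} v f≥2 with v Fin.zero in v₀
... | true with true-entry (λ i → v (Fin.suc i)) (+-cancelˡ-≤ 1 1 _ f≥2)
...   | r , vr = Fin.zero , Fin.suc r , s≤s z≤n , v₀ , vr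
two-true-entries {suc k} v f≥2 | false with two-true-entries (λ i → v (Fin.suc i)) f≥2
...   | r₁ , r₂ , r₁<r₂ , vr₁ , vr₂ = Fin.suc r₁ , Fin.suc r₂ , s≤s r₁<r₂ , vr₁ , vr₂

three-true-entries : ∀ {k} (v : Vector Bool k) → f v ≥ 3 →
                     ∃[ r₁ ] ∃[ r₂ ] ∃[ r₃ ]
                       (r₁ Fin.< r₂ × r₂ Fin.< r₃ × v r₁ ≡ true × v r₂ ≡ true × v r₃ ≡ true)
three-true-entries {suc k} v f≥3 with v Fin.zero in v₀
... | true with two-true-entries (λ i → v (Fin.suc i)) (+-cancelˡ-≤ 1 2 _ f≥3)
...   | r₁ , r₂ , r₁<r₂ , vr₁ , vr₂ =
  Fin.zero , Fin.suc r₁ , Fin.suc r₂ , s≤s z≤n , s≤s r₁<r₂ , v₀ , vr₁ , vr₂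
three-true-entries {suc k} v f≥3 | false with three-true-entries (λ i → v (Fin.suc i)) f≥3
...   | r₁ , r₂ , r₃ , r₁<r₂ , r₂<r₃ , vr₁ , vr₂ , vr₃ =
  Fin.suc r₁ , Fin.suc r₂ , Fin.suc r₃ , s≤s r₁<r₂ , s≤s r₂<r₃ , vr₁ , vr₂ , vr₃

C-successor : ∀ {s} (a : Fin s) → ∃[ b ] C s a b ≡ 1
C-successor {suc s} a = fromℕ< a+1%s<s , b2n-⌊⌋ (_ ≟ _) (toℕ-fromℕ< a+1%s<s)
  where a+1%s<s = m%n<n (suc (toℕ a)) (suc s)

C-predecessor : ∀ {s} (a : Fin s) → ∃[ b ] C s b a ≡ 1
C-predecessor {suc s} Fin.zero = fromℕ s , b2n-⌊⌋ (_ ≟ _)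
  (sym (trans (cong (λ m → suc m % suc s) (toℕ-fromℕ s)) (n%n≡0 (suc s))))
C-predecessor {suc (suc s)} (Fin.suc a) = inject₁ a , b2n-⌊⌋ (_ ≟ _)
  (sym (trans (cong (λ m → suc m % suc (suc s)) (toℕ-inject₁ a)) (m<n⇒m%n≡m (s≤s (toℕ<n a)))))

C₂-swap : ∀ (i : Fin 2) → ∃[ j ] (C 2 i j ≡ 1 × C 2 j i ≡ 1)
C₂-swap Fin.zero           = Fin.suc Fin.zero , refl , refl
C₂-swap (Fin.suc Fin.zero) = Fin.zero , refl , refl

module Block (k s : ℕ) (x y : Fin s → Vector Bool k) where

  A : Matrix (k + s)
  A = blockA k s x y

  open Walks A public

  L : Fin k → Fin (k + s)
  L a = a ↑ˡ s

  R : Fin s → Fin (k + s)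
  R b = k ↑ʳ b

  A-T : ∀ {a b} → a Fin.< b → 1 ≤ A (L a) (L b)
  A-T {a} {b} a<b rewrite splitAt-↑ˡ k a s | splitAt-↑ˡ k b s
    = 1≤-reflexive (b2n-⌊⌋ (toℕ a <? toℕ b) a<b)

  A-X : ∀ {a b} → x b a ≡ true → 1 ≤ A (L a) (R b)
  A-X {a} {b} xba rewrite splitAt-↑ˡ k a s | splitAt-↑ʳ k s b | xba = ≤-refl

  A-Y : ∀ {a b} → y a b ≡ true → 1 ≤ A (R a) (L b)
  A-Y {a} {b} yab rewrite splitAt-↑ʳ k s a | splitAt-↑ˡ k b s | yab = ≤-refl

  A-C : ∀ {a b} → C s a b ≡ 1 → 1 ≤ A (R a) (R b)
  A-C {a} {b} Cab rewrite splitAt-↑ʳ k s a | splitAt-↑ʳ k s b | Cab = ≤-refl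

  L≢R : ∀ {a b} → L a ≢ R b
  L≢R {a} {b} La≡Rb with trans (sym (splitAt-↑ˡ k a s)) (trans (cong (splitAt k) La≡Rb) (splitAt-↑ʳ k s b))
  ... | ()

  L-< : ∀ {a b} → a Fin.< b → L a ≢ L b
  L-< {a} {b} a<b La≡Lb = <⇒≢ a<b (↑ˡ-injective s a b La≡Lb)

  R-out : ∀ a → ∃[ b ] 1 ≤ A (R a) (R b)
  R-out a with C-successor a
  ... | b , Cab = b , A-C Cab

  R-in : ∀ a → ∃[ b ] 1 ≤ A (R b) (R a)
  R-in a with C-predecessor a
  ... | b , Cba = b , A-C Cba

  x-fork : ∀ i → f (x i) ≥ 3 → ∀ q w → 1 ≤ (A ^ᴹ q) (R i) w → ∃[ r ] 2 ≤ (A ^ᴹ (2 + q)) (L r) w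
  x-fork i f≥3 q w 1≤Aᑫiw with three-true-entries (x i) f≥3
  ... | r₁ , r₂ , r₃ , r₁<r₂ , r₂<r₃ , _ , xr₂ , xr₃ =
    r₁ , ^ᴹ-fork (suc q) (L r₁) w (L-< r₂<r₃) (A-T r₁<r₂) (A-T (<-trans r₁<r₂ r₂<r₃))
           (^ᴹ-step q (L r₂) (R i) w (A-X xr₂) 1≤Aᑫiw)
           (^ᴹ-step q (L r₃) (R i) w (A-X xr₃) 1≤Aᑫiw)

  y-fork : ∀ i → f (y i) ≥ 3 → ∃[ c ] 2 ≤ (A ^ᴹ 2) (R i) (L c)
  y-fork i f≥3 with three-true-entries (y i) f≥3
  ... | c₁ , c₂ , c₃ , c₁<c₂ , c₂<c₃ , yc₁ , yc₂ , _ =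
    c₃ , ^ᴹ-fork 1 (R i) (L c₃) (L-< c₁<c₂) (A-Y yc₁) (A-Y yc₂)
           (^ᴹ-one (L c₁) (L c₃) (A-T (<-trans c₁<c₂ c₂<c₃))) (^ᴹ-one (L c₂) (L c₃) (A-T c₂<c₃))

  many-ones-in-x⇒∉Γ : ∀ i → f (x i) ≥ 3 → ∀ q → ¬ Γ (k + s) (2 + q) A
  many-ones-in-x⇒∉Γ i f≥3 q (_ , is01) with ^ᴹ-out-closed R R-out q i
  ... | w , 1≤Aᑫiw with x-fork i f≥3 q w 1≤Aᑫiw
  ... | r , 2≤A²⁺ᑫrw = 2≤⇒¬Is01 (L r) w 2≤A²⁺ᑫrw is01

  many-ones-in-y⇒∉Γ : ∀ i → f (y i) ≥ 3 → ∀ q → ¬ Γ (k + s) (2 + q) A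
  many-ones-in-y⇒∉Γ i f≥3 q (_ , is01) with y-fork i f≥3
  ... | c , 2≤A²ic with ^ᴹ-in-closed R R-in q 2 i (L c) 2≤A²ic
  ... | b , 2≤Aᑫ⁺²bc =
    2≤⇒¬Is01 (R b) (L c) (subst (λ p → 2 ≤ (A ^ᴹ p) (R b) (L c)) (+-comm q 2) 2≤Aᑫ⁺²bc) is01

two-ones-in-x-and-y⇒∉Γ : ∀ k (x y : Fin 2 → Vector Bool k) i → f (x i) ≥ 2 → f (y i) ≥ 2 →
                         ∀ q → ¬ Γ (k + 2) (3 + q) (blockA k 2 x y)
two-ones-in-x-and-y⇒∉Γ k x y i fx≥2 fy≥2 q (_ , is01)
  with two-true-entries (x i) fx≥2 | two-true-entries (y i) fy≥2 | C₂-swap i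
... | a , b , a<b , xa , xb | c , d , c<d , yc , yd | j , Cij , Cji =
  2≤⇒¬Is01 (L a) (L d)
    (^ᴹ-fork (2 + q) (L a) (L d) L≢R (A-T a<b) (A-X xa)
       (^ᴹ-step (suc q) (L b) (R i) (L d) (A-X xb) (i⇝d q)) (i⇝d (suc q)))
    is01
  where
  open Block k 2 x y
  i⇝d : ∀ n → 1 ≤ (A ^ᴹ suc n) (R i) (L d)
  i⇝d zero          = ^ᴹ-one (R i) (L d) (A-Y yd)
  i⇝d (suc zero)    = ^ᴹ-step 1 (R i) (L c) (L d) (A-Y yc) (^ᴹ-one (L c) (L d) (A-T c<d))
  i⇝d (suc (suc n)) = ^ᴹ-step (2 + n) (R i) (R j) (L d) (A-C Cij)
                        (^ᴹ-step (suc n) (R j) (R i) (L d) (A-C Cji) (i⇝d n))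

lemma11 : (k s : ℕ) → k ≥ 5 → s ≥ 1 → (x y : Fin s → Vector Bool k) →
    ((∃[ i ] (f (x i) ≥ 3 ⊎ f (y i) ≥ 3)) → ∀ p → p ≥ 2 → ¬ Γ (k + s) p (blockA k s x y))
    × (s ≡ 2 → (∃[ i ] (f (x i) ≡ 2 × f (y i) ≡ 2)) → ∀ p → p ≥ 5 → ¬ Γ (k + s) p (blockA k s x y))
lemma11 k s _ _ x y = part-i , part-ii
  where
  part-i : (∃[ i ] (f (x i) ≥ 3 ⊎ f (y i) ≥ 3)) → ∀ p → p ≥ 2 → ¬ Γ (k + s) p (blockA k s x y)
  part-i (i , inj₁ fx≥3) (suc (suc q)) (s≤s (s≤s z≤n)) = Block.many-ones-in-x⇒∉Γ k s x y i fx≥3 q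
  part-i (i , inj₂ fy≥3) (suc (suc q)) (s≤s (s≤s z≤n)) = Block.many-ones-in-y⇒∉Γ k s x y i fy≥3 q

  part-ii : s ≡ 2 → (∃[ i ] (f (x i) ≡ 2 × f (y i) ≡ 2)) → ∀ p → p ≥ 5 → ¬ Γ (k + s) p (blockA k s x y)
  part-ii refl (i , fx≡2 , fy≡2) (suc (suc (suc q))) (s≤s (s≤s (s≤s _))) =
    two-ones-in-x-and-y⇒∉Γ k x y i (≤-reflexive (sym fx≡2)) (≤-reflexive (sym fy≡2)) q
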